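{- Let $G=(V,E)$ be a hypergraph and $U\subseteq V$. Then \[ \Psi(G,x)=\sum_{\substack{W\subseteq U\\ W\text{ is independent in } G}}x^{|U\setminus W|}\cdot\Psi\bigl((G_{\div W})_{ -(U\setminus W)},x\bigr) =\sum_{\substack{W\subseteq U\\ V\setminus W\text{ is a vertex cover of } G}}x^{|U\setminus W|}\cdot\Psi\bigl((G_{\div W})_{ -(U\setminus W)},x\bigr). \]
   Context: A hypergraph $G=(V,E)$ consists of a finite vertex set $V$ and a finite multiset $E$ of non-empty subsets of $V$ (edges). A set $W\subseteq V$ is independent in $G$ if no edge $e\in E$ satisfies $e\subseteq W$. A set $W\subseteq V$ is a vertex cover of $G$ if $e\cap W\neq\emptyset$ for all $e\in E$; the vertex cover polynomial is $\Psi(G,x)=\sum_{W\subseteq V,\ W\text{ vertex cover}}x^{|W|}$. For $W\subseteq V$ containing no edge, $G_{\div W}$ ("hiding" $W$) is the hypergraph with vertex set $V\setminus W$ and edge multiset $\{e\setminus W: e\in E\}$. For a hypergraph $H$ and a set $S$ of its vertices, $H_{ -S}$ is obtained by deleting the vertices of $S$ together with all edges containing at least one of them. (The paper writes the graph in the sum as $G_{\div W -U}$: first hide $W$, then delete the remaining vertices of $U$.) -}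

module Defs where

open import Data.Nat using (ℕ; zero; suc; _+_; _∸_; _≤ᵇ_; _≡ᵇ_)
open import Data.Bool using (Bool; true; false; _∧_; _∨_; not; if_then_else_; T)
open import Data.List using (List; []; _∷_; map; filterᵇ; length; foldr; _++_)
open import Data.Bool.ListAction using (and)
open import Data.Vec using (Vec; []; _∷_; zipWith; toList)
open import Data.Fin.Subset using (Subset; _⊆_; ∣_∣; _∩_; _─_; Nonempty)
open import Data.List.Relation.Unary.All using (All)
open import Relation.Nullary.Decidable using (⌊_⌋)
open import Data.Fin.Subset.Properties using (_⊆?_; nonempty?)
open import Data.Product using (_×_)

-- Polynomials with natural-number coefficients, represented by their
-- coefficient sequence  k ↦ [x^k] p.  Equality of polynomials is
-- pointwise equality of coefficients.

Poly : Set
Poly = ℕ → ℕ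

_⊕_ : Poly → Poly → Poly
(p ⊕ q) k = p k + q k

zeroP : Poly
zeroP _ = 0

xpow*_ : ℕ → Poly → Poly
(xpow* m) p k = if m ≤ᵇ k then p (k ∸ m) else 0

ΣP : {A : Set} → List A → (A → Poly) → Poly
ΣP xs f = foldr (λ a acc → f a ⊕ acc) zeroP xs

-- Hypergraphs on an ambient finite universe Fin n.
-- The vertex set V is a subset of Fin n, edges form a multiset (list)
-- of subsets of Fin n.

record Hypergraph (n : ℕ) : Set where
  constructor hg
  field
    V : Subset n
    E : List (Subset n)
open Hypergraph public

WellFormed : ∀ {n} → Hypergraph n → Set
WellFormed G = All (λ e → Nonempty e × e ⊆ V G) (E G)

allE : {A : Set} → (A → Bool) → List A → Bool
allE p xs = and (map p xs)

allSubsets : ∀ n → List (Subset n)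
allSubsets zero = [] ∷ []
allSubsets (suc n) = map (true ∷_) (allSubsets n) ++ map (false ∷_) (allSubsets n)

independent : ∀ {n} → Hypergraph n → Subset n → Bool
independent G W = allE (λ e → not ⌊ e ⊆? W ⌋) (E G)

isCover : ∀ {n} → Hypergraph n → Subset n → Bool
isCover G W = ⌊ W ⊆? V G ⌋ ∧ allE (λ e → ⌊ nonempty? (e ∩ W) ⌋) (E G)

Ψ : ∀ {n} → Hypergraph n → Poly
Ψ {n} G k = length (filterᵇ (λ W → isCover G W ∧ (∣ W ∣ ≡ᵇ k)) (allSubsets n))

hide : ∀ {n} → Hypergraph n → Subset n → Hypergraph n
hide G W = hg (V G ─ W) (map (λ e → e ─ W) (E G))

delete : ∀ {n} → Hypergraph n → Subset n → Hypergraph n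
delete G S = hg (V G ─ S) (filterᵇ (λ e → not ⌊ nonempty? (e ∩ S) ⌋) (E G))

-- Every subset C of V splits uniquely as (U ∖ W) ∪ C' with W = U ∖ C ⊆ U and
-- C' = C ∖ U ⊆ V ∖ U.  Such a set covers G exactly when W is independent (an
-- edge inside W misses C) and C' meets every edge e ∖ W of G_{÷W} that avoids
-- U ∖ W, i.e. C' is a vertex cover of (G_{÷W})_{-(U∖W)}; the vertices of U ∖ W
-- contribute the factor x^{|U∖W|}.  When every edge lies in V, W is
-- independent iff V ∖ W is a vertex cover, which gives the second sum.

module Submission where

open import Defs
open import Algebra.Bundles using (CommutativeMonoid)
open import Algebra.Properties.CommutativeSemigroup using (interchange)
open import Data.Bool using (Bool; true; false; not; _∧_; _∨_; if_then_else_; T)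
open import Data.Bool.ListAction using (and)
open import Data.Bool.Properties
  using (∧-assoc; ∨-zeroʳ; not-involutive; if-∧; ∧-zeroʳ; ∧-commutativeMonoid)
open import Data.Fin using (Fin; zero; suc)
open import Data.Fin.Properties using (any?)
open import Data.Fin.Subset using (Subset; _⊆_; ∣_∣; _─_; _∩_; _∪_; ∁; ⊤)
open import Data.Fin.Subset.Properties
  using (_⊆?_; nonempty?; _∈?_; drop-∷-⊆; s⊆s; out⊆; ⊆-trans; p─q⊆p;
         p⊆q⇒∁p⊇∁q; x∈p∩q⁻; x∈p∪q⁻; x∈∁p⇒x∉p)
open import Data.List using (List; []; _∷_; map; filterᵇ; length; _++_)
open import Data.List.Properties using (map-∘; filter-≐)
open import Data.List.Relation.Unary.All as All using (All; []; _∷_; universal)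
open import Data.Nat using (ℕ; zero; suc; _+_; _∸_; _≤ᵇ_; _≡ᵇ_)
open import Data.Nat.Properties using (+-assoc; +-comm; +-suc; +-identityʳ; +-commutativeSemigroup)
open import Data.Product using (_×_; _,_)
open import Data.Sum using ([_,_])
open import Data.Vec using ([]; _∷_; here; there)
open import Function using (_∘_; case_of_)
open import Relation.Nullary using (¬_)
open import Relation.Nullary.Decidable using (Dec; does; ⌊_⌋; yes; no; T?; isYes≗does; dec-true; dec-false)
open import Relation.Unary using (Pred; Decidable)
open import Relation.Binary.PropositionalEquality
  using (_≡_; refl; sym; trans; cong; cong₂; subst; _≗_; module ≡-Reasoning)

open ≡-Reasoning


⌊⌋-yes : ∀ {A : Set} (a? : Dec A) → A → ⌊ a? ⌋ ≡ true
⌊⌋-yes a? a = trans (isYes≗does a?) (dec-true a? a)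

-- ⌊ nonempty? (x ∷ p) ⌋ does not reduce to a function of ⌊ nonempty? p ⌋,
-- so edge–set intersections are tested with this structural twin instead.
nonemptyᵇ : ∀ {n} → Subset n → Bool
nonemptyᵇ []      = false
nonemptyᵇ (x ∷ p) = x ∨ nonemptyᵇ p

does-any?-cong : ∀ {n ℓ} {P Q : Pred (Fin n) ℓ} (P? : Decidable P) (Q? : Decidable Q) →
                 (∀ i → does (P? i) ≡ does (Q? i)) → does (any? P?) ≡ does (any? Q?)
does-any?-cong {zero}  P? Q? eq = refl
does-any?-cong {suc n} P? Q? eq =
  cong₂ _∨_ (eq zero) (does-any?-cong (P? ∘ suc) (Q? ∘ suc) (eq ∘ suc))

does-nonempty? : ∀ {n} (p : Subset n) → does (nonempty? p) ≡ nonemptyᵇ p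
does-nonempty? []          = refl
does-nonempty? (true  ∷ p) = refl
does-nonempty? (false ∷ p) =
  trans (does-any?-cong (λ i → suc i ∈? false ∷ p) (_∈? p) (λ _ → refl)) (does-nonempty? p)

⌊nonempty?⌋ : ∀ {n} (p : Subset n) → ⌊ nonempty? p ⌋ ≡ nonemptyᵇ p
⌊nonempty?⌋ p = trans (isYes≗does (nonempty? p)) (does-nonempty? p)


∪-lub : ∀ {n} {p q r : Subset n} → p ⊆ r → q ⊆ r → p ∪ q ⊆ r
∪-lub {p = p} {q} p⊆r q⊆r x∈p∪q = [ p⊆r , q⊆r ] (x∈p∪q⁻ p q x∈p∪q)

p─q⊆∁q : ∀ {n} (p q : Subset n) → p ─ q ⊆ ∁ q
p─q⊆∁q (x ∷ p) (true  ∷ q) (there i∈) = there (p─q⊆∁q p q i∈)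
p─q⊆∁q (x ∷ p) (false ∷ q) here       = here
p─q⊆∁q (x ∷ p) (false ∷ q) (there i∈) = there (p─q⊆∁q p q i∈)

p─r─[q─r]≡p─q : ∀ {n} (p : Subset n) {q r} → r ⊆ q → p ─ r ─ (q ─ r) ≡ p ─ q
p─r─[q─r]≡p─q []      {[]}        {[]}        _   = refl
p─r─[q─r]≡p─q (x ∷ p) {true  ∷ q} {true  ∷ r} r⊆q = cong (false ∷_) (p─r─[q─r]≡p─q p (drop-∷-⊆ r⊆q))
p─r─[q─r]≡p─q (x ∷ p) {false ∷ q} {true  ∷ r} r⊆q = case r⊆q here of λ ()
p─r─[q─r]≡p─q (x ∷ p) {y     ∷ q} {false ∷ r} r⊆q = cong₂ _∷_ refl (p─r─[q─r]≡p─q p (drop-∷-⊆ r⊆q))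

[p─q]∩r≡p∩r : ∀ {n} (p : Subset n) {q r} → r ⊆ ∁ q → (p ─ q) ∩ r ≡ p ∩ r
[p─q]∩r≡p∩r []          {[]}        {[]}        _ = refl
[p─q]∩r≡p∩r (x ∷ p)     {false ∷ q} {y ∷ r}     h = cong₂ _∷_ refl ([p─q]∩r≡p∩r p (drop-∷-⊆ h))
[p─q]∩r≡p∩r (x ∷ p)     {true  ∷ q} {true  ∷ r} h = case h here of λ ()
[p─q]∩r≡p∩r (true  ∷ p) {true  ∷ q} {false ∷ r} h = cong (false ∷_) ([p─q]∩r≡p∩r p (drop-∷-⊆ h))
[p─q]∩r≡p∩r (false ∷ p) {true  ∷ q} {false ∷ r} h = cong (false ∷_) ([p─q]∩r≡p∩r p (drop-∷-⊆ h))

∣p∪q∣≡∣p∣+∣q∣ : ∀ {n} (p : Subset n) {q} → q ⊆ ∁ p → ∣ p ∪ q ∣ ≡ ∣ p ∣ + ∣ q ∣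
∣p∪q∣≡∣p∣+∣q∣ []          {[]}        _ = refl
∣p∪q∣≡∣p∣+∣q∣ (true  ∷ p) {true  ∷ q} h = case h here of λ ()
∣p∪q∣≡∣p∣+∣q∣ (true  ∷ p) {false ∷ q} h = cong suc (∣p∪q∣≡∣p∣+∣q∣ p (drop-∷-⊆ h))
∣p∪q∣≡∣p∣+∣q∣ (false ∷ p) {true  ∷ q} h =
  trans (cong suc (∣p∪q∣≡∣p∣+∣q∣ p (drop-∷-⊆ h))) (sym (+-suc ∣ p ∣ ∣ q ∣))
∣p∪q∣≡∣p∣+∣q∣ (false ∷ p) {false ∷ q} h = ∣p∪q∣≡∣p∣+∣q∣ p (drop-∷-⊆ h)

nonemptyᵇ-∩-∪ : ∀ {n} (p q r : Subset n) →
                nonemptyᵇ (p ∩ (q ∪ r)) ≡ nonemptyᵇ (p ∩ q) ∨ nonemptyᵇ (p ∩ r)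
nonemptyᵇ-∩-∪ []          []          []          = refl
nonemptyᵇ-∩-∪ (false ∷ p) (_     ∷ q) (_     ∷ r) = nonemptyᵇ-∩-∪ p q r
nonemptyᵇ-∩-∪ (true  ∷ p) (true  ∷ q) (_     ∷ r) = refl
nonemptyᵇ-∩-∪ (true  ∷ p) (false ∷ q) (true  ∷ r) = sym (∨-zeroʳ _)
nonemptyᵇ-∩-∪ (true  ∷ p) (false ∷ q) (false ∷ r) = nonemptyᵇ-∩-∪ p q r

p⊆q⇒r⊆∁q⇒p∩r≡∅ : ∀ {n} {p q r : Subset n} → p ⊆ q → r ⊆ ∁ q → nonemptyᵇ (p ∩ r) ≡ false
p⊆q⇒r⊆∁q⇒p∩r≡∅ {p = p} {q} {r} p⊆q r⊆∁q =
  trans (sym (does-nonempty? (p ∩ r))) (dec-false (nonempty? (p ∩ r)) λ (i , i∈p∩r) →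
    let (i∈p , i∈r) = x∈p∩q⁻ p r i∈p∩r in x∈∁p⇒x∉p (r⊆∁q i∈r) (p⊆q i∈p))

nonemptyᵇ-∩-─ : ∀ {n} (p : Subset n) {q r} → p ⊆ q → nonemptyᵇ (p ∩ (q ─ r)) ≡ not (does (p ⊆? r))
nonemptyᵇ-∩-─ []          {[]}        {[]}        _   = refl
nonemptyᵇ-∩-─ (false ∷ p) {_     ∷ q} {_     ∷ r} p⊆q = nonemptyᵇ-∩-─ p (drop-∷-⊆ p⊆q)
nonemptyᵇ-∩-─ (true  ∷ p) {false ∷ q}             p⊆q = case p⊆q here of λ ()
nonemptyᵇ-∩-─ (true  ∷ p) {true  ∷ q} {true  ∷ r} p⊆q = nonemptyᵇ-∩-─ p (drop-∷-⊆ p⊆q)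
nonemptyᵇ-∩-─ (true  ∷ p) {true  ∷ q} {false ∷ r} p⊆q = refl


∑⊆ : ∀ {n} → Subset n → (Subset n → ℕ) → ℕ
∑⊆ []          f = f []
∑⊆ (true  ∷ S) f = ∑⊆ S (f ∘ (true ∷_)) + ∑⊆ S (f ∘ (false ∷_))
∑⊆ (false ∷ S) f = ∑⊆ S (f ∘ (false ∷_))

syntax ∑⊆ S (λ C → e) = ∑[ C ⊆ S ] e

⟦_⟧ : Bool → ℕ
⟦ b ⟧ = if b then 1 else 0

∑⊆-cong : ∀ {n} (S : Subset n) {f g : Subset n → ℕ} →
          (∀ C → C ⊆ S → f C ≡ g C) → ∑⊆ S f ≡ ∑⊆ S g
∑⊆-cong []          eq = eq [] (λ ())
∑⊆-cong (true  ∷ S) eq =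
  cong₂ _+_ (∑⊆-cong S λ C C⊆S → eq (true ∷ C) (s⊆s C⊆S)) (∑⊆-cong S λ C C⊆S → eq (false ∷ C) (out⊆ C⊆S))
∑⊆-cong (false ∷ S) eq = ∑⊆-cong S λ C C⊆S → eq (false ∷ C) (out⊆ C⊆S)

∑⊆-zero : ∀ {n} (S : Subset n) → ∑[ C ⊆ S ] 0 ≡ 0
∑⊆-zero []          = refl
∑⊆-zero (true  ∷ S) = cong₂ _+_ (∑⊆-zero S) (∑⊆-zero S)
∑⊆-zero (false ∷ S) = ∑⊆-zero S

∑⊆-distrib-+ : ∀ {n} (S : Subset n) (f g : Subset n → ℕ) →
               ∑[ C ⊆ S ] (f C + g C) ≡ ∑⊆ S f + ∑⊆ S g
∑⊆-distrib-+ []          f g = refl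
∑⊆-distrib-+ {suc n} (true  ∷ S) f g =
  trans (cong₂ _+_ (∑⊆-distrib-+ S (fix-true f) (fix-true g)) (∑⊆-distrib-+ S (fix-false f) (fix-false g)))
        (interchange +-commutativeSemigroup (∑⊆ S (fix-true f)) (∑⊆ S (fix-true g)) (∑⊆ S (fix-false f)) (∑⊆ S (fix-false g)))
  where
  fix-true fix-false : (Subset (suc n) → ℕ) → Subset n → ℕ
  fix-true h = h ∘ (true ∷_)
  fix-false h = h ∘ (false ∷_)
∑⊆-distrib-+ (false ∷ S) f g = ∑⊆-distrib-+ S (f ∘ (false ∷_)) (g ∘ (false ∷_))

∑⊆-guard : ∀ {n} (S : Subset n) b (f : Subset n → ℕ) →
           ∑[ C ⊆ S ] (if b then f C else 0) ≡ (if b then ∑⊆ S f else 0)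
∑⊆-guard S true  f = refl
∑⊆-guard S false f = ∑⊆-zero S

∑⊆-restrict : ∀ {n} (S : Subset n) (f : Subset n → ℕ) →
              (∀ C → ¬ (C ⊆ S) → f C ≡ 0) → ∑⊆ ⊤ f ≡ ∑⊆ S f
∑⊆-restrict []          f vanish = refl
∑⊆-restrict (true  ∷ S) f vanish =
  cong₂ _+_ (∑⊆-restrict S _ λ C C⊈S → vanish (true ∷ C) (C⊈S ∘ drop-∷-⊆))
            (∑⊆-restrict S _ λ C C⊈S → vanish (false ∷ C) (C⊈S ∘ drop-∷-⊆))
∑⊆-restrict {suc n} (false ∷ S) f vanish =
  cong₂ _+_ (trans (∑⊆-cong ⊤ λ C _ → vanish (true ∷ C) λ C⊆S → case C⊆S here of λ ()) (∑⊆-zero (⊤ {n})))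
            (∑⊆-restrict S _ λ C C⊈S → vanish (false ∷ C) (C⊈S ∘ drop-∷-⊆))

∑⊆-split : ∀ {n} {U V : Subset n} (f : Subset n → ℕ) → U ⊆ V →
           ∑⊆ V f ≡ ∑[ W ⊆ U ] ∑[ C ⊆ V ─ U ] f ((U ─ W) ∪ C)
∑⊆-split {U = []}        {[]}        f _   = refl
∑⊆-split {U = true  ∷ U} {true  ∷ V} f U⊆V =
  trans (+-comm (∑⊆ V (f ∘ (true ∷_))) (∑⊆ V (f ∘ (false ∷_))))
        (cong₂ _+_ (∑⊆-split (f ∘ (false ∷_)) (drop-∷-⊆ U⊆V)) (∑⊆-split (f ∘ (true ∷_)) (drop-∷-⊆ U⊆V)))
∑⊆-split {U = true  ∷ U} {false ∷ V} f U⊆V = case U⊆V here of λ ()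
∑⊆-split {U = false ∷ U} {true  ∷ V} f U⊆V =
  trans (cong₂ _+_ (∑⊆-split (f ∘ (true ∷_)) (drop-∷-⊆ U⊆V)) (∑⊆-split (f ∘ (false ∷_)) (drop-∷-⊆ U⊆V)))
        (sym (∑⊆-distrib-+ U _ _))
∑⊆-split {U = false ∷ U} {false ∷ V} f U⊆V = ∑⊆-split (f ∘ (false ∷_)) (drop-∷-⊆ U⊆V)

m+n≡ᵇo : ∀ m n o → (m + n ≡ᵇ o) ≡ ((m ≤ᵇ o) ∧ (n ≡ᵇ o ∸ m))
m+n≡ᵇo zero          n o       = refl
m+n≡ᵇo (suc m)       n zero    = refl
m+n≡ᵇo (suc zero)    n (suc o) = refl
m+n≡ᵇo (suc (suc m)) n (suc o) = m+n≡ᵇo (suc m) n o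

∑⊆-shift : ∀ {n} (S : Subset n) (P : Subset n → Bool) m k →
           ∑[ C ⊆ S ] ⟦ P C ∧ (m + ∣ C ∣ ≡ᵇ k) ⟧ ≡ (xpow* m) (λ j → ∑[ C ⊆ S ] ⟦ P C ∧ (∣ C ∣ ≡ᵇ j) ⟧) k
∑⊆-shift S P m k =
  trans (∑⊆-cong S λ C _ → cong (λ b → ⟦ P C ∧ b ⟧) (m+n≡ᵇo m ∣ C ∣ k)) (by-cases (m ≤ᵇ k))
  where
  by-cases : ∀ b → ∑[ C ⊆ S ] ⟦ P C ∧ (b ∧ (∣ C ∣ ≡ᵇ k ∸ m)) ⟧
                 ≡ (if b then ∑[ C ⊆ S ] ⟦ P C ∧ (∣ C ∣ ≡ᵇ k ∸ m) ⟧ else 0)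
  by-cases true  = refl
  by-cases false = trans (∑⊆-cong S λ C _ → cong ⟦_⟧ (∧-zeroʳ (P C))) (∑⊆-zero S)

ΣP-++ : ∀ {A : Set} (xs ys : List A) (F : A → Poly) → ΣP (xs ++ ys) F ≗ ΣP xs F ⊕ ΣP ys F
ΣP-++ []       ys F k = refl
ΣP-++ (x ∷ xs) ys F k = trans (cong (F x k +_) (ΣP-++ xs ys F k)) (sym (+-assoc (F x k) _ _))

ΣP-map : ∀ {A B : Set} (g : A → B) (xs : List A) (F : B → Poly) → ΣP (map g xs) F ≗ ΣP xs (F ∘ g)
ΣP-map g []       F k = refl
ΣP-map g (x ∷ xs) F k = cong (F (g x) k +_) (ΣP-map g xs F k)

ΣP-filterᵇ : ∀ {A : Set} (p : A → Bool) (xs : List A) (F : A → Poly) →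
             ΣP (filterᵇ p xs) F ≗ ΣP xs (λ a k → if p a then F a k else 0)
ΣP-filterᵇ p []       F k = refl
ΣP-filterᵇ p (x ∷ xs) F k with p x
... | true  = cong (F x k +_) (ΣP-filterᵇ p xs F k)
... | false = ΣP-filterᵇ p xs F k

filterᵇ-cong : ∀ {A : Set} {p q : A → Bool} → (∀ a → p a ≡ q a) → filterᵇ p ≗ filterᵇ q
filterᵇ-cong {p = p} {q} eq =
  filter-≐ (T? ∘ p) (T? ∘ q) ((λ {a} → subst T (eq a)) , (λ {a} → subst T (sym (eq a))))

length≡ΣP-1 : ∀ {A : Set} (xs : List A) k → length xs ≡ ΣP xs (λ _ _ → 1) k
length≡ΣP-1 []       k = refl
length≡ΣP-1 (x ∷ xs) k = cong suc (length≡ΣP-1 xs k)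

ΣP-allSubsets : ∀ n (F : Subset n → Poly) k → ΣP (allSubsets n) F k ≡ ∑[ W ⊆ ⊤ ] F W k
ΣP-allSubsets zero    F k = +-identityʳ (F [] k)
ΣP-allSubsets (suc n) F k = begin
  ΣP (map (true ∷_) (allSubsets n) ++ map (false ∷_) (allSubsets n)) F k
    ≡⟨ ΣP-++ (map (true ∷_) (allSubsets n)) _ F k ⟩
  ΣP (map (true ∷_) (allSubsets n)) F k + ΣP (map (false ∷_) (allSubsets n)) F k
    ≡⟨ cong₂ _+_ (ΣP-map (true ∷_) (allSubsets n) F k) (ΣP-map (false ∷_) (allSubsets n) F k) ⟩
  ΣP (allSubsets n) (F ∘ (true ∷_)) k + ΣP (allSubsets n) (F ∘ (false ∷_)) k
    ≡⟨ cong₂ _+_ (ΣP-allSubsets n _ k) (ΣP-allSubsets n _ k) ⟩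
  ∑[ W ⊆ ⊤ ] F W k ∎

ΣP-filterᵇ-allSubsets : ∀ n (p : Subset n → Bool) (F : Subset n → Poly) k →
                        ΣP (filterᵇ p (allSubsets n)) F k ≡ ∑[ W ⊆ ⊤ ] (if p W then F W k else 0)
ΣP-filterᵇ-allSubsets n p F k = trans (ΣP-filterᵇ p (allSubsets n) F k) (ΣP-allSubsets n _ k)


allE-cong : ∀ {A : Set} {p q : A → Bool} {xs : List A} → All (λ a → p a ≡ q a) xs → allE p xs ≡ allE q xs
allE-cong []         = refl
allE-cong (eq ∷ eqs) = cong₂ _∧_ eq (allE-cong eqs)

allE-∧ : ∀ {A : Set} (p q : A → Bool) (xs : List A) → allE (λ a → p a ∧ q a) xs ≡ allE p xs ∧ allE q xs
allE-∧ p q []       = refl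
allE-∧ p q (x ∷ xs) =
  trans (cong ((p x ∧ q x) ∧_) (allE-∧ p q xs))
        (interchange (CommutativeMonoid.commutativeSemigroup ∧-commutativeMonoid) (p x) (q x) _ _)

allE-filterᵇ : ∀ {A : Set} (p q : A → Bool) (xs : List A) →
               allE q (filterᵇ p xs) ≡ allE (λ a → not (p a) ∨ q a) xs
allE-filterᵇ p q []       = refl
allE-filterᵇ p q (x ∷ xs) with p x
... | true  = cong (q x ∧_) (allE-filterᵇ p q xs)
... | false = allE-filterᵇ p q xs


covers : ∀ {n} → List (Subset n) → Subset n → Bool
covers es X = allE (λ e → nonemptyᵇ (e ∩ X)) es

isCover≡ : ∀ {n} (H : Hypergraph n) X → isCover H X ≡ ⌊ X ⊆? V H ⌋ ∧ covers (E H) X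
isCover≡ H X = cong (⌊ X ⊆? V H ⌋ ∧_) (allE-cong (universal (λ e → ⌊nonempty?⌋ (e ∩ X)) (E H)))

isCover-delete : ∀ {n} (H : Hypergraph n) S C →
                 isCover (delete H S) C ≡ ⌊ C ⊆? V H ─ S ⌋ ∧ covers (E H) (S ∪ C)
isCover-delete H S C = trans (isCover≡ (delete H S) C) (cong (⌊ C ⊆? V H ─ S ⌋ ∧_) (begin
  covers (filterᵇ (λ e → not ⌊ nonempty? (e ∩ S) ⌋) (E H)) C
    ≡⟨ allE-filterᵇ _ _ (E H) ⟩
  allE (λ e → not (not ⌊ nonempty? (e ∩ S) ⌋) ∨ nonemptyᵇ (e ∩ C)) (E H)
    ≡⟨ allE-cong (universal met (E H)) ⟩
  covers (E H) (S ∪ C) ∎))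
  where
  met : ∀ e → not (not ⌊ nonempty? (e ∩ S) ⌋) ∨ nonemptyᵇ (e ∩ C) ≡ nonemptyᵇ (e ∩ (S ∪ C))
  met e = trans (cong (_∨ _) (trans (not-involutive _) (⌊nonempty?⌋ (e ∩ S)))) (sym (nonemptyᵇ-∩-∪ e S C))

covers-hide : ∀ {n} (H : Hypergraph n) {W X} → X ⊆ ∁ W → covers (E (hide H W)) X ≡ covers (E H) X
covers-hide H {W} {X} X⊆∁W =
  trans (cong and (sym (map-∘ (E H))))
        (allE-cong (universal (λ e → cong nonemptyᵇ ([p─q]∩r≡p∩r e X⊆∁W)) (E H)))

covers≡independent∧covers : ∀ {n} (H : Hypergraph n) {W X} → X ⊆ ∁ W →
                            covers (E H) X ≡ independent H W ∧ covers (E H) X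
covers≡independent∧covers H {W} {X} X⊆∁W =
  trans (allE-cong (universal met (E H))) (allE-∧ _ _ (E H))
  where
  met : ∀ e → nonemptyᵇ (e ∩ X) ≡ not ⌊ e ⊆? W ⌋ ∧ nonemptyᵇ (e ∩ X)
  met e with e ⊆? W
  ... | yes e⊆W = p⊆q⇒r⊆∁q⇒p∩r≡∅ e⊆W X⊆∁W
  ... | no  _   = refl

independent≡isCover[V─W] : ∀ {n} (H : Hypergraph n) → WellFormed H →
                           ∀ W → independent H W ≡ isCover H (V H ─ W)
independent≡isCover[V─W] H wf W = sym (begin
  isCover H (V H ─ W)
    ≡⟨ isCover≡ H (V H ─ W) ⟩
  ⌊ V H ─ W ⊆? V H ⌋ ∧ covers (E H) (V H ─ W)
    ≡⟨ cong (_∧ covers (E H) (V H ─ W)) (⌊⌋-yes (V H ─ W ⊆? V H) (p─q⊆p (V H) W)) ⟩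
  covers (E H) (V H ─ W)
    ≡⟨ allE-cong (All.map (λ (_ , e⊆V) → missesW e⊆V) wf) ⟩
  independent H W ∎)
  where
  missesW : ∀ {e} → e ⊆ V H → nonemptyᵇ (e ∩ (V H ─ W)) ≡ not ⌊ e ⊆? W ⌋
  missesW {e} e⊆V = trans (nonemptyᵇ-∩-─ e e⊆V) (cong not (sym (isYes≗does (e ⊆? W))))


Ψ-as-∑⊆ : ∀ {n} (H : Hypergraph n) k → Ψ H k ≡ ∑[ C ⊆ V H ] ⟦ isCover H C ∧ (∣ C ∣ ≡ᵇ k) ⟧
Ψ-as-∑⊆ {n} H k = begin
  Ψ H k                                              ≡⟨ length≡ΣP-1 (filterᵇ P (allSubsets n)) k ⟩
  ΣP (filterᵇ P (allSubsets n)) (λ _ _ → 1) k         ≡⟨ ΣP-filterᵇ-allSubsets n P (λ _ _ → 1) k ⟩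
  ∑[ C ⊆ ⊤ ] ⟦ P C ⟧                                  ≡⟨ ∑⊆-restrict (V H) _ vanishes-outside-V ⟩
  ∑[ C ⊆ V H ] ⟦ P C ⟧                                ∎
  where
  P : Subset n → Bool
  P C = isCover H C ∧ (∣ C ∣ ≡ᵇ k)
  vanishes-outside-V : ∀ C → ¬ (C ⊆ V H) → ⟦ P C ⟧ ≡ 0
  vanishes-outside-V C C⊈V with C ⊆? V H
  ... | yes C⊆V = case C⊈V C⊆V of λ ()
  ... | no  _   = refl

Ψ-shift : ∀ {n} (H : Hypergraph n) m k →
          ∑[ C ⊆ V H ] ⟦ isCover H C ∧ (m + ∣ C ∣ ≡ᵇ k) ⟧ ≡ (xpow* m) (Ψ H) k
Ψ-shift H m k = trans (∑⊆-shift (V H) (isCover H) m k)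
                      (cong (λ x → if m ≤ᵇ k then x else 0) (sym (Ψ-as-∑⊆ H (k ∸ m))))

module _ {n} (G : Hypergraph n) {U : Subset n} (U⊆V : U ⊆ V G) where

  contribution : Subset n → Poly
  contribution W = (xpow* ∣ U ─ W ∣) (Ψ (delete (hide G W) (U ─ W)))

  module _ {W : Subset n} (W⊆U : W ⊆ U) where

    isCover-split : ∀ {C} → C ⊆ V G ─ U →
                    isCover G ((U ─ W) ∪ C) ≡ independent G W ∧ isCover (delete (hide G W) (U ─ W)) C
    isCover-split {C} C⊆V─U = begin
      isCover G X                                          ≡⟨ isCover≡ G X ⟩
      ⌊ X ⊆? V G ⌋ ∧ covers (E G) X                        ≡⟨ cong (_∧ covers (E G) X) (⌊⌋-yes (X ⊆? V G) X⊆V) ⟩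
      covers (E G) X                                       ≡⟨ covers≡independent∧covers G X⊆∁W ⟩
      independent G W ∧ covers (E G) X                     ≡⟨ cong (independent G W ∧_) (sym (covers-hide G X⊆∁W)) ⟩
      independent G W ∧ covers (E (hide G W)) X            ≡⟨ cong (independent G W ∧_) (sym isCover-G') ⟩
      independent G W ∧ isCover (delete (hide G W) (U ─ W)) C ∎
      where
      X : Subset n
      X = (U ─ W) ∪ C
      C⊆∁U : C ⊆ ∁ U
      C⊆∁U = ⊆-trans C⊆V─U (p─q⊆∁q (V G) U)
      X⊆V : X ⊆ V G
      X⊆V = ∪-lub (⊆-trans (p─q⊆p U W) U⊆V) (⊆-trans C⊆V─U (p─q⊆p (V G) U))
      X⊆∁W : X ⊆ ∁ W
      X⊆∁W = ∪-lub (p─q⊆∁q U W) (⊆-trans C⊆∁U (p⊆q⇒∁p⊇∁q W⊆U))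
      isCover-G' : isCover (delete (hide G W) (U ─ W)) C ≡ covers (E (hide G W)) X
      isCover-G' = trans (isCover-delete (hide G W) (U ─ W) C)
        (cong (_∧ covers (E (hide G W)) X)
              (⌊⌋-yes (C ⊆? V G ─ W ─ (U ─ W)) (subst (C ⊆_) (sym (p─r─[q─r]≡p─q (V G) W⊆U)) C⊆V─U)))

    inner-∑≡contribution : ∀ k → ∑[ C ⊆ V G ─ U ] ⟦ isCover G ((U ─ W) ∪ C) ∧ (∣ (U ─ W) ∪ C ∣ ≡ᵇ k) ⟧
               ≡ (if independent G W then contribution W k else 0)
    inner-∑≡contribution k = begin
      ∑[ C ⊆ V G ─ U ] ⟦ isCover G ((U ─ W) ∪ C) ∧ (∣ (U ─ W) ∪ C ∣ ≡ᵇ k) ⟧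
        ≡⟨ ∑⊆-cong (V G ─ U) (λ C C⊆ → cong₂ (λ b s → ⟦ b ∧ (s ≡ᵇ k) ⟧) (isCover-split C⊆) (size-split C⊆)) ⟩
      ∑[ C ⊆ V G ─ U ] ⟦ (independent G W ∧ isCover G' C) ∧ (m + ∣ C ∣ ≡ᵇ k) ⟧
        ≡⟨ ∑⊆-cong (V G ─ U) (λ C _ → trans (cong ⟦_⟧ (∧-assoc (independent G W) _ _)) (if-∧ (independent G W))) ⟩
      ∑[ C ⊆ V G ─ U ] (if independent G W then ⟦ isCover G' C ∧ (m + ∣ C ∣ ≡ᵇ k) ⟧ else 0)
        ≡⟨ ∑⊆-guard (V G ─ U) (independent G W) _ ⟩
      (if independent G W then ∑[ C ⊆ V G ─ U ] ⟦ isCover G' C ∧ (m + ∣ C ∣ ≡ᵇ k) ⟧ else 0)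
        ≡⟨ cong (λ x → if independent G W then x else 0) shifted ⟩
      (if independent G W then (xpow* m) (Ψ G') k else 0) ∎
      where
      G' : Hypergraph n
      G' = delete (hide G W) (U ─ W)
      m : ℕ
      m = ∣ U ─ W ∣
      size-split : ∀ {C} → C ⊆ V G ─ U → ∣ (U ─ W) ∪ C ∣ ≡ m + ∣ C ∣
      size-split C⊆V─U = ∣p∪q∣≡∣p∣+∣q∣ (U ─ W)
        (⊆-trans C⊆V─U (⊆-trans (p─q⊆∁q (V G) U) (p⊆q⇒∁p⊇∁q (p─q⊆p U W))))
      shifted : ∑[ C ⊆ V G ─ U ] ⟦ isCover G' C ∧ (m + ∣ C ∣ ≡ᵇ k) ⟧ ≡ (xpow* m) (Ψ G') k
      shifted = trans (cong (λ S → ∑[ C ⊆ S ] ⟦ isCover G' C ∧ (m + ∣ C ∣ ≡ᵇ k) ⟧)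
                            (sym (p─r─[q─r]≡p─q (V G) W⊆U)))
                      (Ψ-shift G' m k)

  Ψ-expansion : Ψ G ≗ ΣP (filterᵇ (λ W → ⌊ W ⊆? U ⌋ ∧ independent G W) (allSubsets n)) contribution
  Ψ-expansion k = begin
    Ψ G k
      ≡⟨ Ψ-as-∑⊆ G k ⟩
    ∑[ C ⊆ V G ] ⟦ isCover G C ∧ (∣ C ∣ ≡ᵇ k) ⟧
      ≡⟨ ∑⊆-split (λ C → ⟦ isCover G C ∧ (∣ C ∣ ≡ᵇ k) ⟧) U⊆V ⟩
    ∑[ W ⊆ U ] ∑[ C ⊆ V G ─ U ] ⟦ isCover G ((U ─ W) ∪ C) ∧ (∣ (U ─ W) ∪ C ∣ ≡ᵇ k) ⟧
      ≡⟨ ∑⊆-cong U (λ W W⊆U → trans (inner-∑≡contribution W⊆U k) (sym (drop-guard W⊆U))) ⟩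
    ∑[ W ⊆ U ] (if ⌊ W ⊆? U ⌋ ∧ independent G W then contribution W k else 0)
      ≡⟨ sym (∑⊆-restrict U _ vanishes-outside-U) ⟩
    ∑[ W ⊆ ⊤ ] (if ⌊ W ⊆? U ⌋ ∧ independent G W then contribution W k else 0)
      ≡⟨ sym (ΣP-filterᵇ-allSubsets n _ contribution k) ⟩
    ΣP (filterᵇ (λ W → ⌊ W ⊆? U ⌋ ∧ independent G W) (allSubsets n)) contribution k ∎
    where
    drop-guard : ∀ {W} → W ⊆ U → (if ⌊ W ⊆? U ⌋ ∧ independent G W then contribution W k else 0)
                                ≡ (if independent G W then contribution W k else 0)
    drop-guard {W} W⊆U = cong (λ b → if b ∧ independent G W then contribution W k else 0) (⌊⌋-yes (W ⊆? U) W⊆U)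
    vanishes-outside-U : ∀ W → ¬ (W ⊆ U) → (if ⌊ W ⊆? U ⌋ ∧ independent G W then contribution W k else 0) ≡ 0
    vanishes-outside-U W W⊈U with W ⊆? U
    ... | yes W⊆U = case W⊈U W⊆U of λ ()
    ... | no  _   = refl

  Ψ-expansion-covers : WellFormed G →
    Ψ G ≗ ΣP (filterᵇ (λ W → ⌊ W ⊆? U ⌋ ∧ isCover G (V G ─ W)) (allSubsets n)) contribution
  Ψ-expansion-covers wf k = trans (Ψ-expansion k) (cong (λ Ws → ΣP Ws contribution k)
    (filterᵇ-cong (λ W → cong (⌊ W ⊆? U ⌋ ∧_) (independent≡isCover[V─W] G wf W)) (allSubsets n)))

mainTheorem15 : ∀ (n : ℕ) (G : Hypergraph n) → WellFormed G →
    (U : Subset n) → U ⊆ V G →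
    (Ψ G ≗ ΣP (filterᵇ (λ W → ⌊ W ⊆? U ⌋ ∧ independent G W) (allSubsets n))
              (λ W → (xpow* ∣ U ─ W ∣) (Ψ (delete (hide G W) (U ─ W)))))
    × (Ψ G ≗ ΣP (filterᵇ (λ W → ⌊ W ⊆? U ⌋ ∧ isCover G (V G ─ W)) (allSubsets n))
              (λ W → (xpow* ∣ U ─ W ∣) (Ψ (delete (hide G W) (U ─ W)))))
mainTheorem15 n G wf U U⊆V = Ψ-expansion G U⊆V , Ψ-expansion-covers G U⊆V wf
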